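{- Let $G$ be a finite oriented graph and let $v_0$ be a vertex of minimum out-degree in $G$ with $d^+(v_0)=3$. Suppose that every out-neighbor of $v_0$ has out-degree exactly $1$ in the induced subgraph $G[N^+(v_0)]$. Then $v_0$ or one of its out-neighbors is a degree-doubling node (a vertex $v$ with $|N^{++}(v)|\ge|N^+(v)|$).
   Context: An oriented graph is a directed graph with no loops and at most one arc between any two vertices. $N^+(v)=\{w: v\to w\}$, $d^+(v)=|N^+(v)|$, and $N^{++}(v)=\{w: \exists x,\ v\to x\to w,\ w\notin N^+(v)\}$. $G[S]$ is the subgraph induced on the vertex set $S$. -}

module Defs where

open import Data.Nat using (ℕ; _≤_; _≥_)
open import Data.Bool using (Bool; true; false; _∧_; not; T)
open import Data.Fin using (Fin)
open import Data.Fin.Subset using (Subset; _∩_; ∣_∣; _∈_)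
open import Data.Vec using (tabulate)
open import Data.List using (List; allFin)
open import Data.Bool.ListAction using (any)
open import Relation.Binary.PropositionalEquality using (_≡_)

-- A (finite) directed graph on vertex set Fin n, given by its arc relation:
-- E v w ≡ true  iff  there is an arc v → w.
Digraph : ℕ → Set
Digraph n = Fin n → Fin n → Bool

record Oriented {n : ℕ} (E : Digraph n) : Set where
  field
    noLoop : ∀ v → E v v ≡ false
    noDigon : ∀ v w → T (E v w) → E w v ≡ false

allV : (n : ℕ) → List (Fin n)
allV n = allFin n

outN : {n : ℕ} → Digraph n → Fin n → Subset n
outN E v = tabulate (λ w → E v w)

outdeg : {n : ℕ} → Digraph n → Fin n → ℕ
outdeg E v = ∣ outN E v ∣

outN2 : {n : ℕ} → Digraph n → Fin n → Subset n
outN2 {n} E v = tabulate (λ w → any (λ x → E v x ∧ E x w) (allV n) ∧ not (E v w))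

inducedOutdeg : {n : ℕ} → Digraph n → Subset n → Fin n → ℕ
inducedOutdeg E S u = ∣ outN E u ∩ S ∣

DegreeDoubling : {n : ℕ} → Digraph n → Fin n → Set
DegreeDoubling E v = ∣ outN2 E v ∣ ≥ ∣ outN E v ∣

{-# OPTIONS --safe #-}
module Submission where

-- Every out-neighbour u of v has at least two out-neighbours outside N⁺(v), and
-- they all lie in N⁺⁺(v). So if v is not degree doubling, |N⁺⁺(v)| = 2, every
-- u ∈ N⁺(v) dominates N⁺⁺(v), and d⁺(u) = 3. Fix such an a and some x ∈ N⁺⁺(v).
-- The common out-neighbours of x and a lie in N⁺⁺(v) - x, so x has at least two
-- out-neighbours outside N⁺(a), all of them in N⁺⁺(a). Following the arcs of
-- G[N⁺(v)] twice from a gives one more vertex c ∈ N⁺⁺(a), and c is not one of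
-- those out-neighbours of x because c → x. Hence |N⁺⁺(a)| ≥ 3 = d⁺(a).

open import Defs
open import Data.Nat using (ℕ; suc; _+_; _≤_; _<_; z≤n; s≤s; _≤?_)
open import Data.Nat.Properties
  using (≤-trans; ≤-pred; <⇒≱; >⇒≢; ≰⇒>; +-monoˡ-≤; +-suc; module ≤-Reasoning)
open import Data.Fin using (Fin)
open import Data.Fin.Properties using (_≟_)
open import Data.Fin.Subset
  using (Subset; _∈_; _∉_; _⊆_; _∩_; ∁; _-_; ∣_∣; Nonempty; inside; outside)
open import Data.Fin.Subset.Properties
  using ( p⊆q⇒∣p∣≤∣q∣; p⊂q⇒∣p∣<∣q∣; ∣⁅x⁆∣≡1; x∈⁅y⁆⇒x≡y; x∈p⇒∣p-x∣<∣p∣; x∈p∧x≢y⇒x∈p-y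
        ; nonempty?; Empty-unique; ∣⊥∣≡0; _∈?_; p∩q⊆p; p∩q⊆q; x∈p∩q⁺; x∈p∩q⁻; x∉p⇒x∈∁p; x∈∁p⇒x∉p)
open import Data.Bool using (Bool; false; T; _∧_)
open import Data.Bool.ListAction using (any)
open import Data.Bool.Properties using (T-≡; T-∧; T-not-≡; ¬-not)
open import Data.List.Membership.Propositional using (lose)
open import Data.List.Membership.Propositional.Properties using (∈-allFin)
open import Data.List.Relation.Unary.Any.Properties using (any⁺)
open import Data.Vec using (_∷_; []; tabulate)
open import Data.Vec.Properties using ([]=⇒lookup; lookup⇒[]=; lookup∘tabulate)
open import Data.Sum using (_⊎_; inj₁; inj₂)
open import Data.Product using (∃; _×_; _,_)
open import Function using (Equivalence)
open import Relation.Nullary using (yes; no; contradiction)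
open import Relation.Binary.PropositionalEquality using (_≡_; refl; sym; trans; cong; subst)

open Equivalence using (to; from)

private
  variable
    n : ℕ

x∈p⇒0<∣p∣ : ∀ {x} {p : Subset n} → x ∈ p → 0 < ∣ p ∣
x∈p⇒0<∣p∣ {x = x} x∈p = subst (_≤ _) (∣⁅x⁆∣≡1 x)
  (p⊆q⇒∣p∣≤∣q∣ λ y∈⁅x⁆ → subst (_∈ _) (sym (x∈⁅y⁆⇒x≡y x y∈⁅x⁆)) x∈p)

0<∣p∣⇒Nonempty : ∀ {p : Subset n} → 0 < ∣ p ∣ → Nonempty p
0<∣p∣⇒Nonempty {n} {p} 0<∣p∣ with nonempty? p
... | yes nonempty = nonempty
... | no empty = contradiction (trans (cong ∣_∣ (Empty-unique empty)) (∣⊥∣≡0 n)) (>⇒≢ 0<∣p∣)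

∣p∣≤1∧x∈p∧y∈p⇒x≡y : ∀ {p : Subset n} {x y} → ∣ p ∣ ≤ 1 → x ∈ p → y ∈ p → x ≡ y
∣p∣≤1∧x∈p∧y∈p⇒x≡y {p = p} {x} {y} ∣p∣≤1 x∈p y∈p with x ≟ y
... | yes x≡y = x≡y
... | no x≢y = contradiction ∣p∣≤1 (<⇒≱ (≤-trans (s≤s 0<∣p-x∣) (x∈p⇒∣p-x∣<∣p∣ x∈p)))
  where
  0<∣p-x∣ : 0 < ∣ p - x ∣
  0<∣p-x∣ = x∈p⇒0<∣p∣ (x∈p∧x≢y⇒x∈p-y y∈p (λ y≡x → x≢y (sym y≡x)))

∣p∣≡∣p∩q∣+∣p∩∁q∣ : ∀ (p q : Subset n) → ∣ p ∣ ≡ ∣ p ∩ q ∣ + ∣ p ∩ ∁ q ∣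
∣p∣≡∣p∩q∣+∣p∩∁q∣ []            []            = refl
∣p∣≡∣p∩q∣+∣p∩∁q∣ (outside ∷ p) (_       ∷ q) = ∣p∣≡∣p∩q∣+∣p∩∁q∣ p q
∣p∣≡∣p∩q∣+∣p∩∁q∣ (inside  ∷ p) (inside  ∷ q) = cong suc (∣p∣≡∣p∩q∣+∣p∩∁q∣ p q)
∣p∣≡∣p∩q∣+∣p∩∁q∣ (inside  ∷ p) (outside ∷ q) =
  trans (cong suc (∣p∣≡∣p∩q∣+∣p∩∁q∣ p q)) (sym (+-suc ∣ p ∩ q ∣ ∣ p ∩ ∁ q ∣))

p⊆q∧∣q∣≤∣p∣⇒q⊆p : ∀ {p q : Subset n} → p ⊆ q → ∣ q ∣ ≤ ∣ p ∣ → q ⊆ p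
p⊆q∧∣q∣≤∣p∣⇒q⊆p {p = p} p⊆q ∣q∣≤∣p∣ {x} x∈q with x ∈? p
... | yes x∈p = x∈p
... | no x∉p = contradiction ∣q∣≤∣p∣ (<⇒≱ (p⊂q⇒∣p∣<∣q∣ (p⊆q , x , x∈q , x∉p)))

∈-tabulate⁺ : ∀ (f : Fin n → Bool) {x} → T (f x) → x ∈ tabulate f
∈-tabulate⁺ f {x} t = lookup⇒[]= x (tabulate f) (trans (lookup∘tabulate f x) (T-≡ .to t))

∈-tabulate⁻ : ∀ (f : Fin n → Bool) {x} → x ∈ tabulate f → T (f x)
∈-tabulate⁻ f {x} x∈ = T-≡ .from (trans (sym (lookup∘tabulate f x)) ([]=⇒lookup x∈))

∉-tabulate : ∀ (f : Fin n → Bool) {x} → x ∉ tabulate f → f x ≡ false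
∉-tabulate f x∉ = ¬-not (λ fx≡true → x∉ (∈-tabulate⁺ f (T-≡ .from fx≡true)))

module _ (E : Digraph n) where

  outN∩∁outN⊆outN2 : ∀ {v x} → x ∈ outN E v → outN E x ∩ ∁ (outN E v) ⊆ outN2 E v
  outN∩∁outN⊆outN2 {v} {x} x∈N⁺v {w} w∈ with w∈N⁺x , w∈∁N⁺v ← x∈p∩q⁻ _ _ w∈ =
    ∈-tabulate⁺ _ (T-∧ .from (v→x→w , T-not-≡ .from (∉-tabulate (E v) (x∈∁p⇒x∉p w∈∁N⁺v))))
    where
    v→x→w : T (any (λ y → E v y ∧ E y w) (allV n))
    v→x→w = any⁺ _ (lose (∈-allFin x)
      (T-∧ .from (∈-tabulate⁻ (E v) x∈N⁺v , ∈-tabulate⁻ (E x) w∈N⁺x)))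

  module _ (oriented : Oriented E) where
    open Oriented oriented

    outN-irrefl : ∀ v → v ∉ outN E v
    outN-irrefl v v∈N⁺v = subst T (noLoop v) (∈-tabulate⁻ (E v) v∈N⁺v)

    outN-asym : ∀ {v w} → w ∈ outN E v → v ∉ outN E w
    outN-asym {v} {w} w∈N⁺v v∈N⁺w =
      subst T (noDigon v w (∈-tabulate⁻ (E v) w∈N⁺v)) (∈-tabulate⁻ (E w) v∈N⁺w)

module _ {E : Digraph n} (oriented : Oriented E) (outdeg≥3 : ∀ v → 3 ≤ outdeg E v) {v : Fin n}
  (induced≡1 : ∀ u → u ∈ outN E v → inducedOutdeg E (outN E v) u ≡ 1)
  (∣N⁺⁺v∣≤2 : ∣ outN2 E v ∣ ≤ 2) where

  private
    N⁺ N⁺⁺ : Fin n → Subset n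
    N⁺ = outN E
    N⁺⁺ = outN2 E

  ∣N⁺u∣≡1+∣N⁺u∩∁N⁺v∣ : ∀ {u} → u ∈ N⁺ v → ∣ N⁺ u ∣ ≡ 1 + ∣ N⁺ u ∩ ∁ (N⁺ v) ∣
  ∣N⁺u∣≡1+∣N⁺u∩∁N⁺v∣ {u} u∈N⁺v =
    trans (∣p∣≡∣p∩q∣+∣p∩∁q∣ (N⁺ u) (N⁺ v)) (cong (_+ ∣ N⁺ u ∩ ∁ (N⁺ v) ∣) (induced≡1 u u∈N⁺v))

  2≤∣N⁺u∩∁N⁺v∣ : ∀ {u} → u ∈ N⁺ v → 2 ≤ ∣ N⁺ u ∩ ∁ (N⁺ v) ∣
  2≤∣N⁺u∩∁N⁺v∣ {u} u∈N⁺v = ≤-pred (subst (3 ≤_) (∣N⁺u∣≡1+∣N⁺u∩∁N⁺v∣ u∈N⁺v) (outdeg≥3 u))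

  N⁺⁺v⊆N⁺u : ∀ {u} → u ∈ N⁺ v → N⁺⁺ v ⊆ N⁺ u
  N⁺⁺v⊆N⁺u {u} u∈N⁺v x∈N⁺⁺v = p∩q⊆p (N⁺ u) (∁ (N⁺ v)) (p⊆q∧∣q∣≤∣p∣⇒q⊆p
    (outN∩∁outN⊆outN2 E u∈N⁺v) (≤-trans ∣N⁺⁺v∣≤2 (2≤∣N⁺u∩∁N⁺v∣ u∈N⁺v)) x∈N⁺⁺v)

  N⁺u∩N⁺v-nonempty : ∀ {u} → u ∈ N⁺ v → Nonempty (N⁺ u ∩ N⁺ v)
  N⁺u∩N⁺v-nonempty {u} u∈N⁺v = 0<∣p∣⇒Nonempty (subst (0 <_) (sym (induced≡1 u u∈N⁺v)) (s≤s z≤n))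

  module _ {a} (a∈N⁺v : a ∈ N⁺ v) where

    ∣N⁺a∣≤3 : ∣ N⁺ a ∣ ≤ 3
    ∣N⁺a∣≤3 = subst (_≤ 3) (sym (∣N⁺u∣≡1+∣N⁺u∩∁N⁺v∣ a∈N⁺v))
      (s≤s (≤-trans (p⊆q⇒∣p∣≤∣q∣ (outN∩∁outN⊆outN2 E a∈N⁺v)) ∣N⁺⁺v∣≤2))

    N⁺⁺v-nonempty : Nonempty (N⁺⁺ v)
    N⁺⁺v-nonempty = 0<∣p∣⇒Nonempty
      (≤-trans (s≤s z≤n) (≤-trans (2≤∣N⁺u∩∁N⁺v∣ a∈N⁺v) (p⊆q⇒∣p∣≤∣q∣ (outN∩∁outN⊆outN2 E a∈N⁺v))))

    N⁺x∩N⁺a⊆N⁺⁺v-x : ∀ {x} → x ∈ N⁺⁺ v → N⁺ x ∩ N⁺ a ⊆ N⁺⁺ v - x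
    N⁺x∩N⁺a⊆N⁺⁺v-x {x} x∈N⁺⁺v {j} j∈ with j∈N⁺x , j∈N⁺a ← x∈p∩q⁻ (N⁺ x) (N⁺ a) j∈ =
      x∈p∧x≢y⇒x∈p-y (outN∩∁outN⊆outN2 E a∈N⁺v (x∈p∩q⁺ (j∈N⁺a , x∉p⇒x∈∁p j∉N⁺v)))
        (λ { refl → outN-irrefl E oriented j j∈N⁺x })
      where
      j∉N⁺v : j ∉ N⁺ v
      j∉N⁺v j∈N⁺v = outN-asym E oriented j∈N⁺x (N⁺⁺v⊆N⁺u j∈N⁺v x∈N⁺⁺v)

    2≤∣N⁺x∩∁N⁺a∣ : ∀ {x} → x ∈ N⁺⁺ v → 2 ≤ ∣ N⁺ x ∩ ∁ (N⁺ a) ∣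
    2≤∣N⁺x∩∁N⁺a∣ {x} x∈N⁺⁺v = ≤-pred (begin
      3                                       ≤⟨ outdeg≥3 x ⟩
      ∣ N⁺ x ∣                                ≡⟨ ∣p∣≡∣p∩q∣+∣p∩∁q∣ (N⁺ x) (N⁺ a) ⟩
      ∣ N⁺ x ∩ N⁺ a ∣ + ∣ N⁺ x ∩ ∁ (N⁺ a) ∣  ≤⟨ +-monoˡ-≤ ∣ N⁺ x ∩ ∁ (N⁺ a) ∣ ∣N⁺x∩N⁺a∣≤1 ⟩
      1 + ∣ N⁺ x ∩ ∁ (N⁺ a) ∣                ∎)
      where
      open ≤-Reasoning
      ∣N⁺x∩N⁺a∣≤1 : ∣ N⁺ x ∩ N⁺ a ∣ ≤ 1
      ∣N⁺x∩N⁺a∣≤1 = ≤-pred (begin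
        suc ∣ N⁺ x ∩ N⁺ a ∣ ≤⟨ s≤s (p⊆q⇒∣p∣≤∣q∣ (N⁺x∩N⁺a⊆N⁺⁺v-x x∈N⁺⁺v)) ⟩
        suc ∣ N⁺⁺ v - x ∣   ≤⟨ x∈p⇒∣p-x∣<∣p∣ x∈N⁺⁺v ⟩
        ∣ N⁺⁺ v ∣           ≤⟨ ∣N⁺⁺v∣≤2 ⟩
        2                   ∎)

    c∈N⁺⁺a : ∀ {b c} → b ∈ N⁺ a ∩ N⁺ v → c ∈ N⁺ b ∩ N⁺ v → c ∈ N⁺⁺ a
    c∈N⁺⁺a {b} {c} b∈ c∈ with b∈N⁺a , b∈N⁺v ← x∈p∩q⁻ (N⁺ a) (N⁺ v) b∈
                           | c∈N⁺b , c∈N⁺v ← x∈p∩q⁻ (N⁺ b) (N⁺ v) c∈ =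
      outN∩∁outN⊆outN2 E b∈N⁺a (x∈p∩q⁺ (c∈N⁺b , x∉p⇒x∈∁p c∉N⁺a))
      where
      c∉N⁺a : c ∉ N⁺ a
      c∉N⁺a c∈N⁺a = outN-irrefl E oriented b (subst (_∈ N⁺ b) (sym b≡c) c∈N⁺b)
        where
        b≡c : b ≡ c
        b≡c = ∣p∣≤1∧x∈p∧y∈p⇒x≡y (subst (_≤ 1) (sym (induced≡1 a a∈N⁺v)) (s≤s z≤n))
                b∈ (x∈p∩q⁺ (c∈N⁺a , c∈N⁺v))

    3≤∣N⁺⁺a∣ : ∀ {x c} → x ∈ N⁺⁺ v → c ∈ N⁺ v → c ∈ N⁺⁺ a → 3 ≤ ∣ N⁺⁺ a ∣
    3≤∣N⁺⁺a∣ {x} {c} x∈N⁺⁺v c∈N⁺v c∈N⁺⁺a = begin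
      3                        ≤⟨ s≤s (2≤∣N⁺x∩∁N⁺a∣ x∈N⁺⁺v) ⟩
      suc ∣ N⁺ x ∩ ∁ (N⁺ a) ∣  ≤⟨ p⊂q⇒∣p∣<∣q∣ (N⁺x∩∁N⁺a⊆N⁺⁺a , c , c∈N⁺⁺a , c∉N⁺x) ⟩
      ∣ N⁺⁺ a ∣                ∎
      where
      open ≤-Reasoning
      N⁺x∩∁N⁺a⊆N⁺⁺a : N⁺ x ∩ ∁ (N⁺ a) ⊆ N⁺⁺ a
      N⁺x∩∁N⁺a⊆N⁺⁺a = outN∩∁outN⊆outN2 E (N⁺⁺v⊆N⁺u a∈N⁺v x∈N⁺⁺v)
      c∉N⁺x : c ∉ N⁺ x ∩ ∁ (N⁺ a)
      c∉N⁺x c∈ = outN-asym E oriented (N⁺⁺v⊆N⁺u c∈N⁺v x∈N⁺⁺v) (p∩q⊆p (N⁺ x) _ c∈)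

    outNeighbour-degreeDoubling : DegreeDoubling E a
    outNeighbour-degreeDoubling
      with x , x∈N⁺⁺v ← N⁺⁺v-nonempty
         | b , b∈ ← N⁺u∩N⁺v-nonempty a∈N⁺v
      with c , c∈ ← N⁺u∩N⁺v-nonempty (p∩q⊆q (N⁺ a) (N⁺ v) b∈)
      = ≤-trans ∣N⁺a∣≤3 (3≤∣N⁺⁺a∣ x∈N⁺⁺v (p∩q⊆q (N⁺ b) (N⁺ v) c∈) (c∈N⁺⁺a b∈ c∈))

lemma3 : {n : ℕ} (E : Digraph n) → Oriented E → (v₀ : Fin n)
    → (∀ v → outdeg E v₀ ≤ outdeg E v)
    → outdeg E v₀ ≡ 3
    → (∀ u → u ∈ outN E v₀ → inducedOutdeg E (outN E v₀) u ≡ 1)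
    → DegreeDoubling E v₀ ⊎ ∃ (λ u → u ∈ outN E v₀ × DegreeDoubling E u)
lemma3 E oriented v₀ minimal outdeg≡3 induced≡1 with 3 ≤? ∣ outN2 E v₀ ∣
... | yes 3≤∣N⁺⁺v₀∣ = inj₁ (subst (_≤ ∣ outN2 E v₀ ∣) (sym outdeg≡3) 3≤∣N⁺⁺v₀∣)
... | no 3≰∣N⁺⁺v₀∣
  with a , a∈N⁺v₀ ← 0<∣p∣⇒Nonempty (subst (0 <_) (sym outdeg≡3) (s≤s z≤n))
  = inj₂ (a , a∈N⁺v₀ ,
      outNeighbour-degreeDoubling oriented outdeg≥3 induced≡1 (≤-pred (≰⇒> 3≰∣N⁺⁺v₀∣)) a∈N⁺v₀)
  where
  outdeg≥3 : ∀ v → 3 ≤ outdeg E v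
  outdeg≥3 v = subst (_≤ outdeg E v) outdeg≡3 (minimal v)
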